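{- Let $\alpha,\beta,\gamma\in\mathbb{C}$ and let $n>0$ be an integer with $(1-\beta)n-\alpha\neq 0$. Then $$C_{\beta,\gamma}(n)=\sum_{k=0}^{n}(-1)^n\frac{(1-\beta)k-\alpha}{(1-\beta)n-\alpha}\binom{(1-\beta)n-\alpha}{n-k}\binom{\alpha-\gamma}{k}.$$
   Context: For $x\in\mathbb{C}$ and $k$ a positive integer, $\binom{x}{k}=\frac{x(x-1)\cdots(x-k+1)}{k!}$, and $\binom{x}{0}=1$. The generalized Catalan numbers are $C_{\beta,\gamma}(n)=\frac{\gamma}{\beta n+\gamma}\binom{\beta n+\gamma}{n}$, understood for $n\geq1$ as the polynomial $\frac{\gamma}{n}\binom{\beta n+\gamma-1}{n-1}$ (for positive integers $\beta,\gamma$ this counts ordered forests of $\gamma$ $\beta$-ary trees with $n$ internal vertices in total). -}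

module Defs where

open import Level using (_⊔_)
open import Algebra.Bundles using (CommutativeRing)
open import Data.Nat as ℕ using (ℕ; zero; suc; _∸_; s≤s; z≤n)
open import Relation.Nullary using (¬_)

module _ {c ℓ} (R : CommutativeRing c ℓ) where
  open CommutativeRing R

  ι : ℕ → Carrier
  ι zero    = 0#
  ι (suc n) = 1# + ι n

  record CharZeroField : Set (c ⊔ ℓ) where
    field
      inv       : (x : Carrier) → ¬ (x ≈ 0#) → Carrier
      inv-right : (x : Carrier) (p : ¬ (x ≈ 0#)) → x * inv x p ≈ 1#
      charZero  : (n : ℕ) → ¬ (ι (suc n) ≈ 0#)

module _ {c ℓ} {R : CommutativeRing c ℓ} (F : CharZeroField R) where
  open CommutativeRing R
  open CharZeroField F

  sign : ℕ → Carrier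
  sign zero    = 1#
  sign (suc n) = - (sign n)

  sumTo : ℕ → (ℕ → Carrier) → Carrier
  sumTo zero    f = f 0
  sumTo (suc n) f = sumTo n f + f (suc n)

  -- binom x k = x(x-1)...(x-k+1)/k! , computed as ∏_{i<k} (x - i)/(i+1)
  binom : Carrier → ℕ → Carrier
  binom x zero    = 1#
  binom x (suc k) = (binom x k * (x - ι R k)) * inv (ι R (suc k)) (charZero k)

  ι-pos : (n : ℕ) → 0 ℕ.< n → ¬ (ι R n ≈ 0#)
  ι-pos (suc m) (s≤s z≤n) = charZero m

  -- generalized Catalan number for n ≥ 1:  C_{β,γ}(n) = (γ/n) binom(βn+γ-1, n-1)
  catalan : Carrier → Carrier → (n : ℕ) → 0 ℕ.< n → Carrier
  catalan β γ n n>0 =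
    (γ * inv (ι R n) (ι-pos n n>0)) * binom ((β * ι R n + γ) - 1#) (n ∸ 1)

-- Put x = 1 - β, D = xn - α and a = α - γ. The weight xk - α equals D - x(n - k), so the sum
-- splits into D·Σ C(D, n-k) C(a, k) = D·C(D + a, n) (Vandermonde) and
-- x·Σ (n-k) C(D, n-k) C(a, k) = x·D·C(D + a - 1, n - 1) (absorption, then Vandermonde).
-- After dividing by D, upper negation (-1)^j C(y, j) = C(j - 1 - y, j) turns both binomials
-- into ones with upper argument M = βn + γ - 1, and C(M, n) + x·C(M, n-1) = (γ/n)·C(M, n-1).
module Submission where

open import Algebra.Bundles using (CommutativeRing)
import Algebra.Solver.Ring as RingSolver
import Algebra.Solver.Ring.AlmostCommutativeRing as ACR
open import Data.Integer as ℤ using (ℤ; +_; -[1+_]; ∣_∣)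
import Data.Integer.Properties as ℤₚ
open import Data.Maybe as Maybe using (Maybe)
open import Data.Nat as ℕ using (ℕ; zero; suc; _∸_; s≤s; z≤n)
import Data.Nat.Properties as ℕₚ
open import Data.Sign as Sign using (Sign)
open import Data.Sum using (inj₁; inj₂)
import Relation.Binary.PropositionalEquality as ≡
open import Relation.Binary.Consequences using (dec⇒weaklyDec)
open import Relation.Nullary using (¬_)

open import Defs

module _ {c ℓ} (R : CommutativeRing c ℓ) where
  open CommutativeRing R
  open import Algebra.Properties.Semiring.Mult.TCOptimised semiring using (_×_; 1+×; ×-homo-+)
  open import Relation.Binary.Reasoning.Setoid setoid

  ∸-+-homo : ∀ (f : ℕ → Carrier) → (∀ m n → f (m ℕ.+ n) ≈ f m + f n) →
             ∀ {n k} → k ℕ.≤ n → f (n ∸ k) + f k ≈ f n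
  ∸-+-homo f f-+ {n} {k} k≤n = begin
    f (n ∸ k) + f k   ≈⟨ f-+ (n ∸ k) k ⟨
    f (n ∸ k ℕ.+ k)   ≡⟨ ≡.cong f (ℕₚ.m∸n+n≡m k≤n) ⟩
    f n               ∎

  ι≈×1# : ∀ n → ι R n ≈ n × 1#
  ι≈×1# zero    = refl
  ι≈×1# (suc n) = trans (+-congˡ (ι≈×1# n)) (sym (1+× n 1#))

  ι-+ : ∀ m n → ι R (m ℕ.+ n) ≈ ι R m + ι R n
  ι-+ m n = begin
    ι R (m ℕ.+ n)     ≈⟨ ι≈×1# (m ℕ.+ n) ⟩
    (m ℕ.+ n) × 1#    ≈⟨ ×-homo-+ 1# m n ⟩
    m × 1# + n × 1#   ≈⟨ +-cong (ι≈×1# m) (ι≈×1# n) ⟨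
    ι R m + ι R n     ∎

  ι-∸-+ : ∀ {n k} → k ℕ.≤ n → ι R (n ∸ k) + ι R k ≈ ι R n
  ι-∸-+ = ∸-+-homo (ι R) ι-+

module IntegerCoefficientSolver {c ℓ} (R : CommutativeRing c ℓ) where
  open CommutativeRing R
  open import Algebra.Properties.Ring ring using (-1*x≈-x; -‿distribʳ-*)
  open import Algebra.Properties.AbelianGroup +-abelianGroup using (⁻¹-∙-comm; ⁻¹-anti-homo‿-)
  open import Algebra.Properties.Group +-group using (⁻¹-involutive; ε⁻¹≈ε; x≈z//y)
  open import Algebra.Properties.CommutativeSemigroup *-commutativeSemigroup using (interchange)
  open import Algebra.Properties.Semiring.Mult.TCOptimised semiring using (_×_; ×-homo-+; ×1-homo-*)
  open import Relation.Binary.Reasoning.Setoid setoid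

  -- The optimised _×_ makes 1 × 1# reduce to 1#, so the solver's constant 1 is literally 1#.
  fromℤ : ℤ → Carrier
  fromℤ (+ n)    = n × 1#
  fromℤ -[1+ n ] = - (suc n × 1#)

  fromSign : Sign → Carrier
  fromSign Sign.+ = 1#
  fromSign Sign.- = - 1#

  fromℤ-‿homo : ∀ i → fromℤ (ℤ.- i) ≈ - fromℤ i
  fromℤ-‿homo -[1+ n ]  = sym (⁻¹-involutive _)
  fromℤ-‿homo (+ zero)  = sym ε⁻¹≈ε
  fromℤ-‿homo (+ suc n) = refl

  fromℤ-◃ : ∀ s n → fromℤ (s ℤ.◃ n) ≈ fromSign s * n × 1#
  fromℤ-◃ s      zero    = sym (zeroʳ _)
  fromℤ-◃ Sign.+ (suc n) = sym (*-identityˡ _)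
  fromℤ-◃ Sign.- (suc n) = sym (-1*x≈-x _)

  fromℤ≈sign*abs : ∀ i → fromℤ i ≈ fromSign (ℤ.sign i) * ∣ i ∣ × 1#
  fromℤ≈sign*abs i = begin
    fromℤ i                               ≡⟨ ≡.cong fromℤ (ℤₚ.◃-inverse i) ⟨
    fromℤ (ℤ.sign i ℤ.◃ ∣ i ∣)            ≈⟨ fromℤ-◃ (ℤ.sign i) ∣ i ∣ ⟩
    fromSign (ℤ.sign i) * ∣ i ∣ × 1#       ∎

  fromSign-* : ∀ s t → fromSign (s Sign.* t) ≈ fromSign s * fromSign t
  fromSign-* Sign.+ t      = sym (*-identityˡ _)
  fromSign-* Sign.- Sign.+ = sym (*-identityʳ _)
  fromSign-* Sign.- Sign.- = begin
    1#              ≈⟨ ⁻¹-involutive 1# ⟨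
    - - 1#          ≈⟨ -‿cong (-1*x≈-x 1#) ⟨
    - (- 1# * 1#)   ≈⟨ -‿distribʳ-* (- 1#) 1# ⟩
    - 1# * - 1#     ∎

  fromℤ-*-homo : ∀ i j → fromℤ (i ℤ.* j) ≈ fromℤ i * fromℤ j
  fromℤ-*-homo i j = begin
    fromℤ (i ℤ.* j)                                         ≈⟨ fromℤ-◃ (s Sign.* t) (∣ i ∣ ℕ.* ∣ j ∣) ⟩
    fromSign (s Sign.* t) * (∣ i ∣ ℕ.* ∣ j ∣) × 1#            ≈⟨ *-cong (fromSign-* s t) (×1-homo-* ∣ i ∣ ∣ j ∣) ⟩
    (fromSign s * fromSign t) * (∣ i ∣ × 1# * ∣ j ∣ × 1#)    ≈⟨ interchange _ _ _ _ ⟩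
    (fromSign s * ∣ i ∣ × 1#) * (fromSign t * ∣ j ∣ × 1#)    ≈⟨ *-cong (fromℤ≈sign*abs i) (fromℤ≈sign*abs j) ⟨
    fromℤ i * fromℤ j                                       ∎
    where
    s = ℤ.sign i
    t = ℤ.sign j

  fromℤ-⊖ : ∀ m n → fromℤ (m ℤ.⊖ n) ≈ m × 1# - n × 1#
  fromℤ-⊖ m n with ℕₚ.≤-total n m
  ... | inj₁ n≤m = begin
    fromℤ (m ℤ.⊖ n)           ≡⟨ ≡.cong fromℤ (ℤₚ.⊖-≥ n≤m) ⟩
    (m ∸ n) × 1#              ≈⟨ x≈z//y _ _ _ (∸-+-homo R (_× 1#) (×-homo-+ 1#) n≤m) ⟩
    m × 1# - n × 1#           ∎
  ... | inj₂ m≤n = begin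
    fromℤ (m ℤ.⊖ n)           ≡⟨ ≡.cong fromℤ (ℤₚ.⊖-≤ m≤n) ⟩
    fromℤ (ℤ.- (+ (n ∸ m)))   ≈⟨ fromℤ-‿homo (+ (n ∸ m)) ⟩
    - ((n ∸ m) × 1#)          ≈⟨ -‿cong (x≈z//y _ _ _ (∸-+-homo R (_× 1#) (×-homo-+ 1#) m≤n)) ⟩
    - (n × 1# - m × 1#)       ≈⟨ ⁻¹-anti-homo‿- (n × 1#) (m × 1#) ⟩
    m × 1# - n × 1#           ∎

  fromℤ-+-homo : ∀ i j → fromℤ (i ℤ.+ j) ≈ fromℤ i + fromℤ j
  fromℤ-+-homo -[1+ m ] -[1+ n ] = begin
    - (suc (suc (m ℕ.+ n)) × 1#)      ≡⟨ ≡.cong (λ k → - (suc k × 1#)) (ℕₚ.+-suc m n) ⟨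
    - ((suc m ℕ.+ suc n) × 1#)        ≈⟨ -‿cong (×-homo-+ 1# (suc m) (suc n)) ⟩
    - (suc m × 1# + suc n × 1#)       ≈⟨ ⁻¹-∙-comm _ _ ⟨
    - (suc m × 1#) + - (suc n × 1#)   ∎
  fromℤ-+-homo -[1+ m ] (+ n)    = trans (fromℤ-⊖ n (suc m)) (+-comm _ _)
  fromℤ-+-homo (+ m)    -[1+ n ] = fromℤ-⊖ m (suc n)
  fromℤ-+-homo (+ m)    (+ n)    = ×-homo-+ 1# m n

  fromℤ-homomorphism :
    CommutativeRing.rawRing ℤₚ.+-*-commutativeRing ACR.-Raw-AlmostCommutative⟶ ACR.fromCommutativeRing R
  fromℤ-homomorphism = record
    { ⟦_⟧    = fromℤ
    ; +-homo = fromℤ-+-homo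
    ; *-homo = fromℤ-*-homo
    ; -‿homo = fromℤ-‿homo
    ; 0-homo = refl
    ; 1-homo = refl
    }

  fromℤ-≈? : ∀ i j → Maybe (fromℤ i ≈ fromℤ j)
  fromℤ-≈? i j = Maybe.map (λ { ≡.refl → refl }) (dec⇒weaklyDec ℤ._≟_ i j)

  open RingSolver _ (ACR.fromCommutativeRing R) fromℤ-homomorphism fromℤ-≈? public

  :0 :1 : ∀ {n} → Polynomial n
  :0 = con (+ 0)
  :1 = con (+ 1)

module BinomialSums {c ℓ} {R : CommutativeRing c ℓ} (F : CharZeroField R) where
  open CommutativeRing R
  open CharZeroField F
  open IntegerCoefficientSolver R using (solve; _:=_; _:+_; _:*_; _:-_; :-_; :0; :1)
  open import Algebra.Properties.CommutativeSemigroup *-commutativeSemigroup using (x∙yz≈y∙xz)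
  open import Algebra.Properties.CommutativeSemigroup +-commutativeSemigroup
    using () renaming (interchange to +-interchange)
  open import Relation.Binary.Reasoning.Setoid setoid

  ∑ : ℕ → (ℕ → Carrier) → Carrier
  ∑ = sumTo F
  syntax ∑ n (λ k → e) = ∑[ k ≤ n ] e

  infix 8 _C_
  _C_ : Carrier → ℕ → Carrier
  _C_ = binom F

  ∑-cong : ∀ n {f g : ℕ → Carrier} → (∀ {k} → k ℕ.≤ n → f k ≈ g k) → ∑[ k ≤ n ] f k ≈ ∑[ k ≤ n ] g k
  ∑-cong zero    f≈g = f≈g z≤n
  ∑-cong (suc n) f≈g = +-cong (∑-cong n (λ k≤n → f≈g (ℕₚ.m≤n⇒m≤1+n k≤n))) (f≈g ℕₚ.≤-refl)

  ∑-distrib-+ : ∀ n (f g : ℕ → Carrier) → ∑[ k ≤ n ] (f k + g k) ≈ ∑[ k ≤ n ] f k + ∑[ k ≤ n ] g k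
  ∑-distrib-+ zero    f g = refl
  ∑-distrib-+ (suc n) f g = trans (+-congʳ (∑-distrib-+ n f g)) (+-interchange _ _ _ _)

  *-distribˡ-∑ : ∀ n a (f : ℕ → Carrier) → a * ∑[ k ≤ n ] f k ≈ ∑[ k ≤ n ] (a * f k)
  *-distribˡ-∑ zero    a f = refl
  *-distribˡ-∑ (suc n) a f = trans (distribˡ _ _ _) (+-congʳ (*-distribˡ-∑ n a f))

  ∑-suc : ∀ n (f : ℕ → Carrier) → ∑[ k ≤ suc n ] f k ≈ f 0 + ∑[ k ≤ n ] f (suc k)
  ∑-suc zero    f = refl
  ∑-suc (suc n) f = trans (+-congʳ (∑-suc n f)) (+-assoc _ _ _)

  *-cancelˡ : ∀ {x a b} → ¬ x ≈ 0# → x * a ≈ x * b → a ≈ b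
  *-cancelˡ {x} {a} {b} x≉0 xa≈xb = begin
    a                 ≈⟨ x⁻¹[xy]≈y a ⟨
    x⁻¹ * (x * a)     ≈⟨ *-congˡ xa≈xb ⟩
    x⁻¹ * (x * b)     ≈⟨ x⁻¹[xy]≈y b ⟩
    b                 ∎
    where
    x⁻¹ = inv x x≉0
    x⁻¹[xy]≈y : ∀ y → x⁻¹ * (x * y) ≈ y
    x⁻¹[xy]≈y y = begin
      x⁻¹ * (x * y)   ≈⟨ *-assoc x⁻¹ x y ⟨
      (x⁻¹ * x) * y   ≈⟨ *-congʳ (trans (*-comm x⁻¹ x) (inv-right x x≉0)) ⟩
      1# * y          ≈⟨ *-identityˡ y ⟩
      y               ∎

  C-congˡ : ∀ k {x y} → x ≈ y → x C k ≈ y C k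
  C-congˡ zero    x≈y = refl
  C-congˡ (suc k) x≈y = *-congʳ (*-cong (C-congˡ k x≈y) (+-congʳ x≈y))

  [1+k]*xC[1+k]≈xCk*[x-k] : ∀ x k → ι R (suc k) * x C suc k ≈ x C k * (x - ι R k)
  [1+k]*xC[1+k]≈xCk*[x-k] x k = begin
    k+1 * ((x C k * (x - ι R k)) * k+1⁻¹)  ≈⟨ x∙yz≈y∙xz k+1 _ k+1⁻¹ ⟩
    (x C k * (x - ι R k)) * (k+1 * k+1⁻¹)  ≈⟨ *-congˡ (inv-right k+1 (charZero k)) ⟩
    (x C k * (x - ι R k)) * 1#             ≈⟨ *-identityʳ _ ⟩
    x C k * (x - ι R k)                    ∎
    where
    k+1 = ι R (suc k)
    k+1⁻¹ = inv k+1 (charZero k)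

  xCk*[x-k]≈x*[x-1]Ck : ∀ x k → x C k * (x - ι R k) ≈ x * (x - 1#) C k
  xCk*[x-k]≈x*[x-1]Ck x zero    = solve 1 (λ x → :1 :* (x :- :0) := x :* :1) refl x
  xCk*[x-k]≈x*[x-1]Ck x (suc k) = *-cancelˡ (charZero k) (begin
    k+1 * (x C suc k * (x - k+1))       ≈⟨ *-assoc k+1 _ _ ⟨
    (k+1 * x C suc k) * (x - k+1)       ≈⟨ *-congʳ ([1+k]*xC[1+k]≈xCk*[x-k] x k) ⟩
    (x C k * (x - ι R k)) * (x - k+1)   ≈⟨ *-congʳ (xCk*[x-k]≈x*[x-1]Ck x k) ⟩
    (x * x-1Ck) * (x - k+1)             ≈⟨ regroup x x-1Ck (ι R k) ⟩
    x * (x-1Ck * ((x - 1#) - ι R k))    ≈⟨ *-congˡ ([1+k]*xC[1+k]≈xCk*[x-k] (x - 1#) k) ⟨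
    x * (k+1 * (x - 1#) C suc k)        ≈⟨ x∙yz≈y∙xz x k+1 _ ⟩
    k+1 * (x * (x - 1#) C suc k)        ∎)
    where
    k+1 = ι R (suc k)
    x-1Ck = (x - 1#) C k
    regroup : ∀ x c i → (x * c) * (x - (1# + i)) ≈ x * (c * ((x - 1#) - i))
    regroup = solve 3 (λ x c i → (x :* c) :* (x :- (:1 :+ i)) := x :* (c :* ((x :- :1) :- i))) refl

  [-1]^k*xCk≈[k-1-x]Ck : ∀ x k → sign F k * x C k ≈ ((ι R k - 1#) - x) C k
  [-1]^k*xCk≈[k-1-x]Ck x zero    = *-identityˡ 1#
  [-1]^k*xCk≈[k-1-x]Ck x (suc k) = *-cancelˡ (charZero k) (begin
    k+1 * (- sign F k * x C suc k)      ≈⟨ x∙yz≈y∙xz k+1 _ _ ⟩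
    - sign F k * (k+1 * x C suc k)      ≈⟨ *-congˡ ([1+k]*xC[1+k]≈xCk*[x-k] x k) ⟩
    - sign F k * (x C k * (x - ι R k))  ≈⟨ flip-sign (sign F k) (x C k) x (ι R k) ⟩
    (sign F k * x C k) * (ι R k - x)    ≈⟨ *-cong ([-1]^k*xCk≈[k-1-x]Ck x k) k-x≈w ⟩
    ((ι R k - 1#) - x) C k * w          ≈⟨ *-comm _ w ⟩
    w * ((ι R k - 1#) - x) C k          ≈⟨ *-congˡ (C-congˡ k k-1-x≈w-1) ⟩
    w * (w - 1#) C k                    ≈⟨ xCk*[x-k]≈x*[x-1]Ck w k ⟨
    w C k * (w - ι R k)                 ≈⟨ [1+k]*xC[1+k]≈xCk*[x-k] w k ⟨
    k+1 * w C suc k                     ∎)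
    where
    k+1 = ι R (suc k)
    w = (k+1 - 1#) - x
    flip-sign : ∀ s c x i → - s * (c * (x - i)) ≈ (s * c) * (i - x)
    flip-sign = solve 4 (λ s c x i → :- s :* (c :* (x :- i)) := (s :* c) :* (i :- x)) refl
    k-x≈w : ι R k - x ≈ w
    k-x≈w = solve 2 (λ i x → i :- x := ((:1 :+ i) :- :1) :- x) refl (ι R k) x
    k-1-x≈w-1 : (ι R k - 1#) - x ≈ w - 1#
    k-1-x≈w-1 = solve 2 (λ i x → (i :- :1) :- x := (((:1 :+ i) :- :1) :- x) :- :1) refl (ι R k) x

  ∑-absorb-top : ∀ x n (g : ℕ → Carrier) →
    ∑[ k ≤ suc n ] ((ι R (suc n ∸ k) * x C (suc n ∸ k)) * g k) ≈
    ∑[ k ≤ n ] ((x C (n ∸ k) * (x - ι R (n ∸ k))) * g k)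
  ∑-absorb-top x n g = begin
    ∑[ k ≤ n ] f k + f (suc n)   ≈⟨ +-congˡ top≈0 ⟩
    ∑[ k ≤ n ] f k + 0#          ≈⟨ +-identityʳ _ ⟩
    ∑[ k ≤ n ] f k               ≈⟨ ∑-cong n absorb ⟩
    ∑[ k ≤ n ] ((x C (n ∸ k) * (x - ι R (n ∸ k))) * g k) ∎
    where
    f : ℕ → Carrier
    f k = (ι R (suc n ∸ k) * x C (suc n ∸ k)) * g k
    top≈0 : f (suc n) ≈ 0#
    top≈0 = begin
      (ι R (n ∸ n) * x C (n ∸ n)) * g (suc n)  ≡⟨ ≡.cong (λ j → (ι R j * x C j) * g (suc n)) (ℕₚ.n∸n≡0 n) ⟩
      (0# * 1#) * g (suc n)                    ≈⟨ trans (*-congʳ (zeroˡ 1#)) (zeroˡ _) ⟩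
      0#                                       ∎
    absorb : ∀ {k} → k ℕ.≤ n → f k ≈ (x C (n ∸ k) * (x - ι R (n ∸ k))) * g k
    absorb {k} k≤n rewrite ℕₚ.+-∸-assoc 1 k≤n = *-congʳ ([1+k]*xC[1+k]≈xCk*[x-k] x (n ∸ k))

  -- Multiply by n + 1 = (n + 1 - k) + k and absorb each part into the adjacent binomial.
  vandermonde : ∀ x y n → ∑[ k ≤ n ] (x C (n ∸ k) * y C k) ≈ (x + y) C n
  vandermonde x y zero    = *-identityˡ 1#
  vandermonde x y (suc n) = *-cancelˡ (charZero n) (begin
    n+1 * ∑[ k ≤ suc n ] T′ k                  ≈⟨ *-distribˡ-∑ (suc n) n+1 T′ ⟩
    ∑[ k ≤ suc n ] (n+1 * T′ k)                ≈⟨ ∑-cong (suc n) split ⟩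
    ∑[ k ≤ suc n ] (U k + V k)                 ≈⟨ ∑-distrib-+ (suc n) U V ⟩
    ∑[ k ≤ suc n ] U k + ∑[ k ≤ suc n ] V k   ≈⟨ +-cong (∑-absorb-top x n (y C_)) ∑V≈∑V′ ⟩
    ∑[ k ≤ n ] U′ k + ∑[ k ≤ n ] V′ k         ≈⟨ ∑-distrib-+ n U′ V′ ⟨
    ∑[ k ≤ n ] (U′ k + V′ k)                   ≈⟨ ∑-cong n combine ⟩
    ∑[ k ≤ n ] ((x + y - ι R n) * T k)         ≈⟨ *-distribˡ-∑ n _ T ⟨
    (x + y - ι R n) * ∑[ k ≤ n ] T k           ≈⟨ *-congˡ (vandermonde x y n) ⟩
    (x + y - ι R n) * (x + y) C n              ≈⟨ *-comm _ _ ⟩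
    (x + y) C n * (x + y - ι R n)              ≈⟨ [1+k]*xC[1+k]≈xCk*[x-k] (x + y) n ⟨
    n+1 * (x + y) C suc n                      ∎)
    where
    n+1 = ι R (suc n)
    T′ T U V U′ V′ : ℕ → Carrier
    T′ k = x C (suc n ∸ k) * y C k
    T  k = x C (n ∸ k) * y C k
    U  k = (ι R (suc n ∸ k) * x C (suc n ∸ k)) * y C k
    V  k = x C (suc n ∸ k) * (ι R k * y C k)
    U′ k = (x C (n ∸ k) * (x - ι R (n ∸ k))) * y C k
    V′ k = x C (n ∸ k) * (y C k * (y - ι R k))

    split : ∀ {k} → k ℕ.≤ suc n → n+1 * T′ k ≈ U k + V k
    split {k} k≤n+1 = begin
      n+1 * T′ k                          ≈⟨ *-congʳ (ι-∸-+ R k≤n+1) ⟨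
      (ι R (suc n ∸ k) + ι R k) * T′ k    ≈⟨ distribute _ _ _ _ ⟩
      U k + V k                           ∎
      where
      distribute : ∀ i j a b → (i + j) * (a * b) ≈ (i * a) * b + a * (j * b)
      distribute = solve 4 (λ i j a b → (i :+ j) :* (a :* b) := (i :* a) :* b :+ a :* (j :* b)) refl

    ∑V≈∑V′ : ∑[ k ≤ suc n ] V k ≈ ∑[ k ≤ n ] V′ k
    ∑V≈∑V′ = begin
      ∑[ k ≤ suc n ] V k            ≈⟨ ∑-suc n V ⟩
      V 0 + ∑[ k ≤ n ] V (suc k)    ≈⟨ +-cong V0≈0 (∑-cong n (λ {k} _ → *-congˡ ([1+k]*xC[1+k]≈xCk*[x-k] y k))) ⟩
      0# + ∑[ k ≤ n ] V′ k          ≈⟨ +-identityˡ _ ⟩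
      ∑[ k ≤ n ] V′ k               ∎
      where
      V0≈0 : V 0 ≈ 0#
      V0≈0 = trans (*-congˡ (zeroˡ 1#)) (zeroʳ _)

    combine : ∀ {k} → k ℕ.≤ n → U′ k + V′ k ≈ (x + y - ι R n) * T k
    combine {k} k≤n = begin
      U′ k + V′ k                              ≈⟨ collect (x C (n ∸ k)) (y C k) x y (ι R (n ∸ k)) (ι R k) ⟩
      (x + y - (ι R (n ∸ k) + ι R k)) * T k    ≈⟨ *-congʳ (+-congˡ (-‿cong (ι-∸-+ R k≤n))) ⟩
      (x + y - ι R n) * T k                    ∎
      where
      collect : ∀ a b x y i j → (a * (x - i)) * b + a * (b * (y - j)) ≈ (x + y - (i + j)) * (a * b)
      collect = solve 6 (λ a b x y i j → (a :* (x :- i)) :* b :+ a :* (b :* (y :- j)) := (x :+ y :- (i :+ j)) :* (a :* b)) refl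

  absorbed-vandermonde : ∀ x y n →
    ∑[ k ≤ suc n ] ((ι R (suc n ∸ k) * x C (suc n ∸ k)) * y C k) ≈ x * (x + y - 1#) C n
  absorbed-vandermonde x y n = begin
    ∑[ k ≤ suc n ] ((ι R (suc n ∸ k) * x C (suc n ∸ k)) * y C k)  ≈⟨ ∑-absorb-top x n (y C_) ⟩
    ∑[ k ≤ n ] ((x C (n ∸ k) * (x - ι R (n ∸ k))) * y C k)        ≈⟨ ∑-cong n (λ {k} _ → *-congʳ (absorb k)) ⟩
    ∑[ k ≤ n ] ((x * (x - 1#) C (n ∸ k)) * y C k)                 ≈⟨ ∑-cong n (λ _ → *-assoc _ _ _) ⟩
    ∑[ k ≤ n ] (x * ((x - 1#) C (n ∸ k) * y C k))                 ≈⟨ *-distribˡ-∑ n x _ ⟨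
    x * ∑[ k ≤ n ] ((x - 1#) C (n ∸ k) * y C k)                   ≈⟨ *-congˡ (vandermonde (x - 1#) y n) ⟩
    x * (x - 1# + y) C n                                          ≈⟨ *-congˡ (C-congˡ n x-1+y≈x+y-1) ⟩
    x * (x + y - 1#) C n                                          ∎
    where
    absorb : ∀ k → x C (n ∸ k) * (x - ι R (n ∸ k)) ≈ x * (x - 1#) C (n ∸ k)
    absorb k = xCk*[x-k]≈x*[x-1]Ck x (n ∸ k)
    x-1+y≈x+y-1 : x - 1# + y ≈ x + y - 1#
    x-1+y≈x+y-1 = solve 2 (λ x y → x :- :1 :+ y := x :+ y :- :1) refl x y

  linearly-weighted-vandermonde : ∀ z α y n → let D = z * ι R (suc n) - α in
    ∑[ k ≤ suc n ] ((z * ι R k - α) * (D C (suc n ∸ k) * y C k)) ≈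
    D * ((D + y) C suc n - z * (D + y - 1#) C n)
  linearly-weighted-vandermonde z α y n = begin
    ∑[ k ≤ suc n ] ((z * ι R k - α) * T k)
      ≈⟨ ∑-cong (suc n) split ⟩
    ∑[ k ≤ suc n ] (D * T k + (- z) * U k)
      ≈⟨ ∑-distrib-+ (suc n) _ _ ⟩
    ∑[ k ≤ suc n ] (D * T k) + ∑[ k ≤ suc n ] ((- z) * U k)
      ≈⟨ +-cong (*-distribˡ-∑ (suc n) D T) (*-distribˡ-∑ (suc n) (- z) U) ⟨
    D * ∑[ k ≤ suc n ] T k + (- z) * ∑[ k ≤ suc n ] U k
      ≈⟨ +-cong (*-congˡ (vandermonde D y (suc n))) (*-congˡ (absorbed-vandermonde D y n)) ⟩
    D * (D + y) C suc n + (- z) * (D * (D + y - 1#) C n)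
      ≈⟨ solve 4 (λ D z A B → D :* A :+ (:- z) :* (D :* B) := D :* (A :- z :* B)) refl D z _ _ ⟩
    D * ((D + y) C suc n - z * (D + y - 1#) C n)
      ∎
    where
    D = z * ι R (suc n) - α
    T U : ℕ → Carrier
    T k = D C (suc n ∸ k) * y C k
    U k = (ι R (suc n ∸ k) * D C (suc n ∸ k)) * y C k

    split : ∀ {k} → k ℕ.≤ suc n → (z * ι R k - α) * T k ≈ D * T k + (- z) * U k
    split {k} k≤n+1 = begin
      (z * ι R k - α) * T k
        ≈⟨ expand z α (ι R (suc n ∸ k)) (ι R k) (D C (suc n ∸ k)) (y C k) ⟩
      (z * (ι R (suc n ∸ k) + ι R k) - α) * T k + (- z) * U k
        ≈⟨ +-congʳ (*-congʳ (+-congʳ (*-congˡ (ι-∸-+ R k≤n+1)))) ⟩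
      D * T k + (- z) * U k
        ∎
      where
      expand : ∀ z α i j a b → (z * j - α) * (a * b) ≈ (z * (i + j) - α) * (a * b) + (- z) * ((i * a) * b)
      expand = solve 6 (λ z α i j a b →
        (z :* j :- α) :* (a :* b) := (z :* (i :+ j) :- α) :* (a :* b) :+ (:- z) :* ((i :* a) :* b)) refl

  catalan≈binomial-sum : ∀ β γ m → let M = (β * ι R (suc m) + γ) - 1# in
    catalan F β γ (suc m) (s≤s z≤n) ≈ M C suc m + (1# - β) * M C m
  catalan≈binomial-sum β γ m = *-cancelˡ (charZero m) (begin
    n * ((γ * n⁻¹) * M C m)
      ≈⟨ solve 4 (λ n i γ c → n :* ((γ :* i) :* c) := (n :* i) :* (γ :* c)) refl n n⁻¹ γ (M C m) ⟩
    (n * n⁻¹) * (γ * M C m)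
      ≈⟨ trans (*-congʳ (inv-right n (charZero m))) (*-identityˡ _) ⟩
    γ * M C m
      ≈⟨ solve 4 (λ c i β γ →
           γ :* c := c :* (((β :* (:1 :+ i) :+ γ) :- :1) :- i) :+ (:1 :- β) :* ((:1 :+ i) :* c)) refl (M C m) (ι R m) β γ ⟩
    M C m * (M - ι R m) + (1# - β) * (n * M C m)
      ≈⟨ +-congʳ ([1+k]*xC[1+k]≈xCk*[x-k] M m) ⟨
    n * M C suc m + (1# - β) * (n * M C m)
      ≈⟨ solve 4 (λ n a x b → n :* a :+ x :* (n :* b) := n :* (a :+ x :* b)) refl n (M C suc m) (1# - β) (M C m) ⟩
    n * (M C suc m + (1# - β) * M C m)
      ∎)
    where
    n = ι R (suc m)
    n⁻¹ = inv n (charZero m)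
    M = (β * n + γ) - 1#

  alternating-difference≈catalan : ∀ β γ m y → let M = (β * ι R (suc m) + γ) - 1# in
    (ι R (suc m) - 1#) - y ≈ M →
    sign F (suc m) * (y C suc m - (1# - β) * (y - 1#) C m) ≈ catalan F β γ (suc m) (s≤s z≤n)
  alternating-difference≈catalan β γ m y n-1-y≈M = begin
    - sign F m * (y C suc m - (1# - β) * (y - 1#) C m)
      ≈⟨ solve 4 (λ t a x b → :- t :* (a :- x :* b) := (:- t) :* a :+ x :* (t :* b)) refl (sign F m) _ (1# - β) _ ⟩
    sign F (suc m) * y C suc m + (1# - β) * (sign F m * (y - 1#) C m)
      ≈⟨ +-cong (upper-negation (suc m) n-1-y≈M) (*-congˡ (upper-negation m m-1-[y-1]≈M)) ⟩
    M C suc m + (1# - β) * M C m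
      ≈⟨ catalan≈binomial-sum β γ m ⟨
    catalan F β γ (suc m) (s≤s z≤n)
      ∎
    where
    M = (β * ι R (suc m) + γ) - 1#
    upper-negation : ∀ {x} j → (ι R j - 1#) - x ≈ M → sign F j * x C j ≈ M C j
    upper-negation {x} j j-1-x≈M = trans ([-1]^k*xCk≈[k-1-x]Ck x j) (C-congˡ j j-1-x≈M)
    m-1-[y-1]≈M : (ι R m - 1#) - (y - 1#) ≈ M
    m-1-[y-1]≈M = trans (solve 2 (λ i y → (i :- :1) :- (y :- :1) := ((:1 :+ i) :- :1) :- y) refl (ι R m) y) n-1-y≈M

corollary3p3 : ∀ {c ℓ} (R : CommutativeRing c ℓ) (F : CharZeroField R) →
    let open CommutativeRing R in
    (α β γ : Carrier) (n : ℕ) (n>0 : 0 ℕ.< n) →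
    (D≠0 : ¬ (((1# - β) * ι R n) - α ≈ 0#)) →
    catalan F β γ n n>0 ≈
      sumTo F n (λ k →
        ((sign F n * ((((1# - β) * ι R k) - α) * CharZeroField.inv F (((1# - β) * ι R n) - α) D≠0))
          * binom F (((1# - β) * ι R n) - α) (n ∸ k))
          * binom F (α - γ) k)
corollary3p3 R F α β γ (suc m) (s≤s z≤n) D≠0 = sym (begin
  ∑[ k ≤ n ] (((s * ((x * ι R k - α) * D⁻¹)) * D C (n ∸ k)) * a C k)
    ≈⟨ ∑-cong n (λ _ → regroup s _ D⁻¹ _ _) ⟩
  ∑[ k ≤ n ] ((s * D⁻¹) * ((x * ι R k - α) * (D C (n ∸ k) * a C k)))
    ≈⟨ *-distribˡ-∑ n (s * D⁻¹) _ ⟨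
  (s * D⁻¹) * ∑[ k ≤ n ] ((x * ι R k - α) * (D C (n ∸ k) * a C k))
    ≈⟨ *-congˡ (linearly-weighted-vandermonde x α a m) ⟩
  (s * D⁻¹) * (D * Z)
    ≈⟨ solve 4 (λ s i d z → (s :* i) :* (d :* z) := s :* ((d :* i) :* z)) refl s D⁻¹ D Z ⟩
  s * ((D * D⁻¹) * Z)
    ≈⟨ *-congˡ (trans (*-congʳ (inv-right D D≠0)) (*-identityˡ Z)) ⟩
  s * Z
    ≈⟨ alternating-difference≈catalan β γ m (D + a) n-1-[D+a]≈M ⟩
  catalan F β γ n (s≤s z≤n)
    ∎)
  where
  open CommutativeRing R
  open CharZeroField F
  open BinomialSums F
  open IntegerCoefficientSolver R using (solve; _:=_; _:+_; _:*_; _:-_; :1)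
  open import Relation.Binary.Reasoning.Setoid setoid
  n = suc m
  x = 1# - β
  D = x * ι R n - α
  D⁻¹ = inv D D≠0
  a = α - γ
  s = sign F n
  Z = (D + a) C n - x * (D + a - 1#) C m

  regroup : ∀ s w i p q → ((s * (w * i)) * p) * q ≈ (s * i) * (w * (p * q))
  regroup = solve 5 (λ s w i p q → ((s :* (w :* i)) :* p) :* q := (s :* i) :* (w :* (p :* q))) refl

  n-1-[D+a]≈M : (ι R n - 1#) - (D + a) ≈ (β * ι R n + γ) - 1#
  n-1-[D+a]≈M = solve 4 (λ N β α γ → (N :- :1) :- (((:1 :- β) :* N :- α) :+ (α :- γ)) := (β :* N :+ γ) :- :1) refl (ι R n) β α γ
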